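{- For every prime $p\ge 5$, the trinomial coefficient satisfies $$T(2p,p)\equiv 2 \pmod{p^2}.$$
   Context: For an integer $n\ge 0$ and an integer $j$, the trinomial coefficient $T(n,j)$ is the coefficient of $x^j$ in the Laurent polynomial $(1+x+x^{ -1})^n$, i.e. $(1+x+x^{ -1})^n=\sum_{j=-n}^{n}T(n,j)x^j$ (and $T(n,j)=0$ for $|j|>n$). Equivalently, $T(n,j)=\sum_{k=0}^{n}\binom{n}{k}\binom{n-k}{k+j}$. -}

module Defs where

open import Data.Nat using (ℕ; zero; suc; _+_; _∸_)
open import Data.Nat.Combinatorics using (_C_)

sumTo : ℕ → (ℕ → ℕ) → ℕ
sumTo zero    f = f 0
sumTo (suc n) f = sumTo n f + f (suc n)

-- trinomial coefficient T(n,j) for j ≥ 0:  Σ_{k=0}^{n} C(n,k) C(n-k, k+j)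
-- (C(a,b) = 0 when b > a, matching the convention of the paper)
T : ℕ → ℕ → ℕ
T n j = sumTo n (λ k → (n C k) * ((n ∸ k) C (k + j)))
  where open import Data.Nat using (_*_)

module Submission where

-- With Pₙ = (1+x+x²)ⁿ, the trinomial
-- coefficient is T(n,j) = [x^(n+j)] Pₙ, so T(2p,p) = [x^3p] P₂ₚ.  Three facts
-- about these polynomials give the theorem:
--  (1) Frobenius: Pₚ ≡ 1 + (x+x²)ᵖ (mod p) coefficientwise, so p divides
--      [xⁱ] Pₚ whenever 0 < i < 2p and i ≠ p;
--  (2) (1-x)ᵖ·Pₚ = (1-x³)ᵖ has no x^p term when 3 ∤ p, and in the convolution
--      sum for that coefficient all terms but i = 0, p are divisible by p²,
--      whence [xᵖ] Pₚ ≡ 1 (mod p²) for odd p;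
--  (3) P₂ₚ = Pₚ·Pₚ, and in the sum for [x^3p] all terms but i = p, 2p are
--      divisible by p², whence [x^3p] P₂ₚ ≡ 2·[xᵖ] Pₚ (mod p²).

open import Function using (id; _∘_)
open import Data.Nat as ℕ using (ℕ; zero; suc; _∸_; _≤_; _<_; z≤n; s≤s)
import Data.Nat.Properties as ℕₚ
import Data.Nat.Divisibility as ℕᵈ
open import Data.Nat.Tactic.RingSolver as ℕ-Solver using ()
open import Data.Nat.Combinatorics
  using (_C_; nCk+nC[k+1]≡[n+1]C[k+1]; nCk≡nC[n∸k]; nCn≡1; nC1≡n; k>n⇒nCk≡0)
open import Data.Nat.Primality using (Prime; composite; euclidsLemma; prime⇒nonZero)
open import Data.Integer using (ℤ; +_; -_; _+_; _-_; _*_; 0ℤ; 1ℤ; -1ℤ)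
import Data.Integer.Properties as ℤₚ
import Data.Integer.Divisibility as Unsigned
open import Data.Integer.Divisibility.Signed
  using (_∣_; divides; ∣-trans; ∣m∣n⇒∣m+n; ∣m⇒∣-m; ∣n⇒∣m*n; ∣m⇒∣m*n; *-monoˡ-∣; *-monoʳ-∣; ∣ᵤ⇒∣; ∣⇒∣ᵤ)
open import Data.Integer.Tactic.RingSolver using (solve-∀)
open import Data.Sum using (inj₁; inj₂)
open import Data.Empty using (⊥-elim)
open import Relation.Nullary using (¬_)
open import Relation.Binary.Definitions using (tri<; tri≈; tri>)
open import Relation.Binary.PropositionalEquality
open ≡-Reasoning
open import Defs

∑ : ℕ → (ℕ → ℤ) → ℤ
∑ zero    f = f 0
∑ (suc n) f = ∑ n f + f (suc n)

∑-cong : ∀ n {f g : ℕ → ℤ} → (∀ i → i ≤ n → f i ≡ g i) → ∑ n f ≡ ∑ n g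
∑-cong zero    f≡g = f≡g 0 z≤n
∑-cong (suc n) f≡g =
  cong₂ _+_ (∑-cong n (λ i i≤n → f≡g i (ℕₚ.m≤n⇒m≤1+n i≤n))) (f≡g (suc n) ℕₚ.≤-refl)

∑-+ : ∀ n (f g : ℕ → ℤ) → ∑ n (λ i → f i + g i) ≡ ∑ n f + ∑ n g
∑-+ zero    f g = refl
∑-+ (suc n) f g = trans (cong (_+ (f (suc n) + g (suc n))) (∑-+ n f g))
                        (interchange (∑ n f) (∑ n g) (f (suc n)) (g (suc n)))
  where
  interchange : ∀ a b c d → (a + b) + (c + d) ≡ (a + c) + (b + d)
  interchange = solve-∀

∑-neg : ∀ n (f : ℕ → ℤ) → ∑ n (λ i → - f i) ≡ - ∑ n f
∑-neg zero    f = refl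
∑-neg (suc n) f = trans (cong (λ s → s - f (suc n)) (∑-neg n f))
                        (sym (ℤₚ.neg-distrib-+ (∑ n f) (f (suc n))))

∑-zero : ∀ n → ∑ n (λ _ → 0ℤ) ≡ 0ℤ
∑-zero zero    = refl
∑-zero (suc n) = cong (_+ 0ℤ) (∑-zero n)

∑-front : ∀ n (f : ℕ → ℤ) → ∑ (suc n) f ≡ f 0 + ∑ n (λ i → f (suc i))
∑-front zero    f = refl
∑-front (suc n) f = trans (cong (_+ f (suc (suc n))) (∑-front n f)) (ℤₚ.+-assoc (f 0) _ _)

∑-reverse : ∀ n (f : ℕ → ℤ) → ∑ n f ≡ ∑ n (λ k → f (n ∸ k))
∑-reverse zero    f = refl
∑-reverse (suc n) f = sym (begin
    ∑ (suc n) (λ k → f (suc n ∸ k))      ≡⟨ ∑-front n (λ k → f (suc n ∸ k)) ⟩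
    f (suc n) + ∑ n (λ k → f (n ∸ k))    ≡⟨ cong (λ s → f (suc n) + s) (∑-reverse n f) ⟨
    f (suc n) + ∑ n f                    ≡⟨ ℤₚ.+-comm (f (suc n)) (∑ n f) ⟩
    ∑ n f + f (suc n)                    ∎)

∑-sumTo : ∀ n (f : ℕ → ℕ) → + sumTo n f ≡ ∑ n (λ k → + f k)
∑-sumTo zero    f = refl
∑-sumTo (suc n) f =
  trans (ℤₚ.pos-+ (sumTo n f) (f (suc n))) (cong (_+ + f (suc n)) (∑-sumTo n f))

_∣0 : ∀ m → m ∣ 0ℤ
m ∣0 = divides 0ℤ refl

∣-* : ∀ {a b x y} → a ∣ x → b ∣ y → a * b ∣ x * y
∣-* {b = b} {x = x} a∣x b∣y = ∣-trans (*-monoˡ-∣ b a∣x) (*-monoʳ-∣ x b∣y)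

∑-divisible : ∀ {m} n (f : ℕ → ℤ) → (∀ i → i ≤ n → m ∣ f i) → m ∣ ∑ n f
∑-divisible zero    f m∣f = m∣f 0 z≤n
∑-divisible (suc n) f m∣f =
  ∣m∣n⇒∣m+n (∑-divisible n f (λ i i≤n → m∣f i (ℕₚ.m≤n⇒m≤1+n i≤n))) (m∣f (suc n) ℕₚ.≤-refl)

∑-one-term : ∀ {m} n (f : ℕ → ℤ) {a} → a ≤ n →
             (∀ i → i ≤ n → i ≢ a → m ∣ f i) → m ∣ ∑ n f - f a
∑-one-term zero f z≤n _ = subst (_ ∣_) (sym (ℤₚ.+-inverseʳ (f 0))) (_ ∣0)
∑-one-term (suc n) f {a} a≤1+n m∣f with ℕₚ.m≤n⇒m<n∨m≡n a≤1+n
... | inj₁ (s≤s a≤n) =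
  subst (_ ∣_) (move (∑ n f) (f a) (f (suc n)))
        (∣m∣n⇒∣m+n (∑-one-term n f a≤n (λ i i≤n → m∣f i (ℕₚ.m≤n⇒m≤1+n i≤n)))
                   (m∣f (suc n) ℕₚ.≤-refl (λ e → ℕₚ.<-irrefl (sym e) (s≤s a≤n))))
  where
  move : ∀ s x y → (s - x) + y ≡ (s + y) - x
  move = solve-∀
... | inj₂ refl =
  subst (_ ∣_) (cancel (∑ n f) (f (suc n)))
        (∑-divisible n f (λ i i≤n → m∣f i (ℕₚ.m≤n⇒m≤1+n i≤n) (λ e → ℕₚ.<-irrefl e (s≤s i≤n))))
  where
  cancel : ∀ s x → s ≡ (s + x) - x
  cancel = solve-∀

∑-two-terms : ∀ {m} n (f : ℕ → ℤ) {a b} → a < b → b ≤ n →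
              (∀ i → i ≤ n → i ≢ a → i ≢ b → m ∣ f i) → m ∣ ∑ n f - (f a + f b)
∑-two-terms zero f a<b z≤n _ = ⊥-elim (ℕₚ.n≮0 a<b)
∑-two-terms (suc n) f {a} {b} a<b b≤1+n m∣f with ℕₚ.m≤n⇒m<n∨m≡n b≤1+n
... | inj₁ (s≤s b≤n) =
  subst (_ ∣_) (move (∑ n f) (f a + f b) (f (suc n)))
        (∣m∣n⇒∣m+n (∑-two-terms n f a<b b≤n (λ i i≤n → m∣f i (ℕₚ.m≤n⇒m≤1+n i≤n)))
                   (m∣f (suc n) ℕₚ.≤-refl (λ e → ℕₚ.<-irrefl (sym e) (ℕₚ.<-trans a<b (s≤s b≤n)))
                                          (λ e → ℕₚ.<-irrefl (sym e) (s≤s b≤n))))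
  where
  move : ∀ s x y → (s - x) + y ≡ (s + y) - x
  move = solve-∀
... | inj₂ refl =
  subst (_ ∣_) (cancel (∑ n f) (f a) (f (suc n)))
        (∑-one-term n f (ℕₚ.≤-pred a<b)
                    (λ i i≤n i≢a → m∣f i (ℕₚ.m≤n⇒m≤1+n i≤n) i≢a (λ e → ℕₚ.<-irrefl e (s≤s i≤n))))
  where
  cancel : ∀ s x y → s - x ≡ (s + y) - (x + y)
  cancel = solve-∀

-- A polynomial (or power series) f = ∑ᵢ (f i) xⁱ.
Poly : Set
Poly = ℕ → ℤ

one : Poly
one zero    = 1ℤ
one (suc _) = 0ℤ

shift : Poly → Poly
shift f zero    = 0ℤ
shift f (suc i) = f i

_⊕_ : Poly → Poly → Poly
(f ⊕ g) i = f i + g i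

⊝_ : Poly → Poly
(⊝ f) i = - f i

_⊛_ : Poly → Poly → Poly
(f ⊛ g) s = ∑ s (λ i → f i * g (s ∸ i))

⊛-distribʳ-⊕ : ∀ f g h → (f ⊕ g) ⊛ h ≗ (f ⊛ h) ⊕ (g ⊛ h)
⊛-distribʳ-⊕ f g h s =
  trans (∑-cong s (λ i _ → ℤₚ.*-distribʳ-+ (h (s ∸ i)) (f i) (g i))) (∑-+ s _ _)

⊛-distribˡ-⊕ : ∀ f g h → f ⊛ (g ⊕ h) ≗ (f ⊛ g) ⊕ (f ⊛ h)
⊛-distribˡ-⊕ f g h s =
  trans (∑-cong s (λ i _ → ℤₚ.*-distribˡ-+ (f i) (g (s ∸ i)) (h (s ∸ i)))) (∑-+ s _ _)

⊛-negˡ : ∀ f g → (⊝ f) ⊛ g ≗ ⊝ (f ⊛ g)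
⊛-negˡ f g s = trans (∑-cong s (λ i _ → sym (ℤₚ.neg-distribˡ-* (f i) (g (s ∸ i))))) (∑-neg s _)

⊛-negʳ : ∀ f g → f ⊛ (⊝ g) ≗ ⊝ (f ⊛ g)
⊛-negʳ f g s = trans (∑-cong s (λ i _ → sym (ℤₚ.neg-distribʳ-* (f i) (g (s ∸ i))))) (∑-neg s _)

shift-⊛ : ∀ f g → shift f ⊛ g ≗ shift (f ⊛ g)
shift-⊛ f g zero    = ℤₚ.*-zeroˡ (g 0)
shift-⊛ f g (suc s) =
  trans (∑-front s _) (trans (cong (_+ (f ⊛ g) s) (ℤₚ.*-zeroˡ (g (suc s)))) (ℤₚ.+-identityˡ _))

⊛-shift : ∀ f g → f ⊛ shift g ≗ shift (f ⊛ g)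
⊛-shift f g zero    = ℤₚ.*-zeroʳ (f 0)
⊛-shift f g (suc s) = begin
    ∑ s (λ i → f i * shift g (suc s ∸ i)) + f (suc s) * shift g (s ∸ s)
  ≡⟨ cong₂ _+_ (∑-cong s (λ i i≤s → cong (λ j → f i * shift g j) (ℕₚ.+-∸-assoc 1 i≤s)))
               (trans (cong (λ j → f (suc s) * shift g j) (ℕₚ.n∸n≡0 s)) (ℤₚ.*-zeroʳ (f (suc s)))) ⟩
    (f ⊛ g) s + 0ℤ
  ≡⟨ ℤₚ.+-identityʳ _ ⟩
    (f ⊛ g) s ∎

one-⊛ : ∀ g → one ⊛ g ≗ g
one-⊛ g zero    = ℤₚ.*-identityˡ (g 0)
one-⊛ g (suc s) = begin
    ∑ (suc s) (λ i → one i * g (suc s ∸ i))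
  ≡⟨ ∑-front s _ ⟩
    1ℤ * g (suc s) + ∑ s (λ i → 0ℤ * g (s ∸ i))
  ≡⟨ cong₂ _+_ (ℤₚ.*-identityˡ (g (suc s))) (∑-zero s) ⟩
    g (suc s) + 0ℤ
  ≡⟨ ℤₚ.+-identityʳ _ ⟩
    g (suc s) ∎

-- Multipliers: operators L that act as multiplication by a fixed polynomial,
-- i.e. that respect pointwise equality and commute with convolution.

Op : Set
Op = Poly → Poly

record Multiplier (L : Op) : Set where
  field
    resp-≗  : ∀ {f g} → f ≗ g → L f ≗ L g
    ⊛-commˡ : ∀ f g → L f ⊛ g ≗ L (f ⊛ g)
    ⊛-commʳ : ∀ f g → f ⊛ L g ≗ L (f ⊛ g)
open Multiplier

_⊞_ : Op → Op → Op
(L ⊞ M) f = L f ⊕ M f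

_⊟_ : Op → Op → Op
(L ⊟ M) f = L f ⊕ (⊝ M f)

id-multiplier : Multiplier id
id-multiplier = record { resp-≗ = id ; ⊛-commˡ = λ _ _ _ → refl ; ⊛-commʳ = λ _ _ _ → refl }

shift-resp : ∀ {f g} → f ≗ g → shift f ≗ shift g
shift-resp f≗g zero    = refl
shift-resp f≗g (suc i) = f≗g i

shift-multiplier : Multiplier shift
shift-multiplier = record { resp-≗ = shift-resp ; ⊛-commˡ = shift-⊛ ; ⊛-commʳ = ⊛-shift }

∘-multiplier : ∀ {L M} → Multiplier L → Multiplier M → Multiplier (L ∘ M)
∘-multiplier {M = M} 𝓛 𝓜 = record
  { resp-≗  = λ f≗g → resp-≗ 𝓛 (resp-≗ 𝓜 f≗g)
  ; ⊛-commˡ = λ f g s → trans (⊛-commˡ 𝓛 (M f) g s) (resp-≗ 𝓛 (⊛-commˡ 𝓜 f g) s)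
  ; ⊛-commʳ = λ f g s → trans (⊛-commʳ 𝓛 f (M g) s) (resp-≗ 𝓛 (⊛-commʳ 𝓜 f g) s)
  }

⊞-multiplier : ∀ {L M} → Multiplier L → Multiplier M → Multiplier (L ⊞ M)
⊞-multiplier {L} {M} 𝓛 𝓜 = record
  { resp-≗  = λ f≗g i → cong₂ _+_ (resp-≗ 𝓛 f≗g i) (resp-≗ 𝓜 f≗g i)
  ; ⊛-commˡ = λ f g s → trans (⊛-distribʳ-⊕ (L f) (M f) g s)
                              (cong₂ _+_ (⊛-commˡ 𝓛 f g s) (⊛-commˡ 𝓜 f g s))
  ; ⊛-commʳ = λ f g s → trans (⊛-distribˡ-⊕ f (L g) (M g) s)
                              (cong₂ _+_ (⊛-commʳ 𝓛 f g s) (⊛-commʳ 𝓜 f g s))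
  }

⊟-multiplier : ∀ {L M} → Multiplier L → Multiplier M → Multiplier (L ⊟ M)
⊟-multiplier {L} {M} 𝓛 𝓜 = record
  { resp-≗  = λ f≗g i → cong₂ _-_ (resp-≗ 𝓛 f≗g i) (resp-≗ 𝓜 f≗g i)
  ; ⊛-commˡ = λ f g s → trans (⊛-distribʳ-⊕ (L f) (⊝ M f) g s)
                              (cong₂ _+_ (⊛-commˡ 𝓛 f g s)
                                         (trans (⊛-negˡ (M f) g s) (cong -_ (⊛-commˡ 𝓜 f g s))))
  ; ⊛-commʳ = λ f g s → trans (⊛-distribˡ-⊕ f (L g) (⊝ M g) s)
                              (cong₂ _+_ (⊛-commʳ 𝓛 f g s)
                                         (trans (⊛-negʳ f (M g) s) (cong -_ (⊛-commʳ 𝓜 f g s))))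
  }

-- Powers: power L n is the n-th power of the polynomial L multiplies by.
power : Op → ℕ → Poly
power L zero    = one
power L (suc n) = L (power L n)

power-+ : ∀ {L} → Multiplier L → ∀ m n → power L m ⊛ power L n ≗ power L (m ℕ.+ n)
power-+ 𝓛 zero    n = one-⊛ _
power-+ {L} 𝓛 (suc m) n s =
  trans (⊛-commˡ 𝓛 (power L m) (power L n) s) (resp-≗ 𝓛 (power-+ 𝓛 m n) s)

power-⊛ : ∀ {L M N} → Multiplier L → Multiplier M → (∀ f → L (M f) ≗ N f) →
          ∀ n → power L n ⊛ power M n ≗ power N n
power-⊛ 𝓛 𝓜 LM≗N zero = one-⊛ one
power-⊛ {L} {M} {N} 𝓛 𝓜 LM≗N (suc n) s = begin
    (L (power L n) ⊛ M (power M n)) s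
  ≡⟨ ⊛-commˡ 𝓛 (power L n) (M (power M n)) s ⟩
    L (power L n ⊛ M (power M n)) s
  ≡⟨ resp-≗ 𝓛 (⊛-commʳ 𝓜 (power L n) (power M n)) s ⟩
    L (M (power L n ⊛ power M n)) s
  ≡⟨ resp-≗ 𝓛 (resp-≗ 𝓜 (power-⊛ 𝓛 𝓜 LM≗N n)) s ⟩
    L (M (power N n)) s
  ≡⟨ LM≗N (power N n) s ⟩
    N (power N n) s ∎

-- Linear combinations ∑ₖ cₖ Fₖ of polynomials, and operators commuting with
-- them (needed to apply an operator termwise in the binomial theorem).

combination : ℕ → (ℕ → ℤ) → (ℕ → Poly) → Poly
combination n c F i = ∑ n (λ k → c k * F k i)

record Linear (L : Op) : Set where
  field
    ∑-comm : ∀ n c F → L (combination n c F) ≗ combination n c (λ k → L (F k))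
open Linear

shift-linear : Linear shift
∑-comm shift-linear n c F zero    = sym (trans (∑-cong n (λ k _ → ℤₚ.*-zeroʳ (c k))) (∑-zero n))
∑-comm shift-linear n c F (suc i) = refl

∘-linear : ∀ {L M} → Multiplier L → Linear L → Linear M → Linear (L ∘ M)
∑-comm (∘-linear {M = M} 𝓛 lin-L lin-M) n c F i =
  trans (resp-≗ 𝓛 (∑-comm lin-M n c F) i) (∑-comm lin-L n c (λ k → M (F k)) i)

⊞-linear : ∀ {L M} → Linear L → Linear M → Linear (L ⊞ M)
∑-comm (⊞-linear lin-L lin-M) n c F i =
  trans (cong₂ _+_ (∑-comm lin-L n c F i) (∑-comm lin-M n c F i))
        (trans (sym (∑-+ n _ _)) (∑-cong n (λ k _ → sym (ℤₚ.*-distribˡ-+ (c k) _ _))))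

binomial : ∀ {L} → Multiplier L → Linear L →
           ∀ n → power (id ⊞ L) n ≗ combination n (λ k → + (n C k)) (power L)
binomial 𝓛 lin zero    i = sym (ℤₚ.*-identityˡ (one i))
binomial {L} 𝓛 lin (suc n) i = sym (begin
    ∑ (suc n) (λ k → + (suc n C k) * E k i)
  ≡⟨ ∑-front n _ ⟩
    G 0 + ∑ n (λ k → + (suc n C suc k) * E (suc k) i)
  ≡⟨ cong (λ s → G 0 + s) (trans (∑-cong n (λ k _ → pascal k)) (∑-+ n _ _)) ⟩
    G 0 + (∑ n (λ k → + (n C k) * L (E k) i) + ∑ n (λ k → G (suc k)))
  ≡⟨ regroup (G 0) _ _ ⟩
    (G 0 + ∑ n (λ k → G (suc k))) + ∑ n (λ k → + (n C k) * L (E k) i)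
  ≡⟨ cong₂ _+_ lower upper ⟩
    P i + L P i ∎)
  where
  P : Poly
  P = power (id ⊞ L) n
  E : ℕ → Poly
  E = power L
  G : ℕ → ℤ
  G k = + (n C k) * E k i
  pascal : ∀ k → + (suc n C suc k) * E (suc k) i ≡ + (n C k) * E (suc k) i + G (suc k)
  pascal k = begin
      + (suc n C suc k) * E (suc k) i             ≡⟨ cong (λ c → + c * E (suc k) i) (nCk+nC[k+1]≡[n+1]C[k+1] n k) ⟨
      + (n C k ℕ.+ n C suc k) * E (suc k) i       ≡⟨ cong (_* E (suc k) i) (ℤₚ.pos-+ (n C k) (n C suc k)) ⟩
      (+ (n C k) + + (n C suc k)) * E (suc k) i   ≡⟨ ℤₚ.*-distribʳ-+ (E (suc k) i) (+ (n C k)) (+ (n C suc k)) ⟩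
      + (n C k) * E (suc k) i + G (suc k)         ∎
  regroup : ∀ a b c → a + (b + c) ≡ (a + c) + b
  regroup = solve-∀
  lower : G 0 + ∑ n (λ k → G (suc k)) ≡ P i
  lower = begin
      G 0 + ∑ n (λ k → G (suc k))   ≡⟨ ∑-front n G ⟨
      ∑ n G + G (suc n)             ≡⟨ cong (λ c → ∑ n G + + c * E (suc n) i) (k>n⇒nCk≡0 (ℕₚ.n<1+n n)) ⟩
      ∑ n G + 0ℤ                    ≡⟨ ℤₚ.+-identityʳ _ ⟩
      ∑ n G                         ≡⟨ binomial 𝓛 lin n i ⟨
      P i                           ∎
  upper : ∑ n (λ k → + (n C k) * L (E k) i) ≡ L P i
  upper = trans (sym (∑-comm lin n (λ k → + (n C k)) E i)) (resp-≗ 𝓛 (λ j → sym (binomial 𝓛 lin n j)) i)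

absorption : ∀ n k → suc k ℕ.* (suc n C suc k) ≡ suc n ℕ.* (n C k)
absorption zero    zero    = refl
absorption zero    (suc k) = ℕₚ.*-zeroʳ (suc (suc k))
absorption (suc n) zero    =
  trans (ℕₚ.*-identityˡ _) (trans (nC1≡n (suc (suc n))) (sym (ℕₚ.*-identityʳ (suc (suc n)))))
absorption (suc n) (suc k) = begin
    suc (suc k) ℕ.* (suc (suc n) C suc (suc k))
  ≡⟨ cong (suc (suc k) ℕ.*_) (nCk+nC[k+1]≡[n+1]C[k+1] (suc n) (suc k)) ⟨
    suc (suc k) ℕ.* (a ℕ.+ b)
  ≡⟨ expand k a b ⟩
    a ℕ.+ suc k ℕ.* a ℕ.+ suc (suc k) ℕ.* b
  ≡⟨ cong₂ (λ x y → a ℕ.+ x ℕ.+ y) (absorption n k) (absorption n (suc k)) ⟩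
    a ℕ.+ suc n ℕ.* (n C k) ℕ.+ suc n ℕ.* (n C suc k)
  ≡⟨ ℕₚ.+-assoc a _ _ ⟩
    a ℕ.+ (suc n ℕ.* (n C k) ℕ.+ suc n ℕ.* (n C suc k))
  ≡⟨ cong (a ℕ.+_) (ℕₚ.*-distribˡ-+ (suc n) (n C k) (n C suc k)) ⟨
    a ℕ.+ suc n ℕ.* (n C k ℕ.+ n C suc k)
  ≡⟨ cong (λ x → a ℕ.+ suc n ℕ.* x) (nCk+nC[k+1]≡[n+1]C[k+1] n k) ⟩
    suc (suc n) ℕ.* a ∎
  where
  a b : ℕ
  a = suc n C suc k
  b = suc n C suc (suc k)
  expand : ∀ m x y → suc (suc m) ℕ.* (x ℕ.+ y) ≡ x ℕ.+ suc m ℕ.* x ℕ.+ suc (suc m) ℕ.* y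
  expand = ℕ-Solver.solve-∀

-- p divides C(p,k) for 0 < k < p: p divides k·C(p,k) = p·C(p-1,k-1) but not k.
prime∣binomial : ∀ {p k} → Prime p → 0 < k → k < p → p ℕᵈ.∣ p C k
prime∣binomial {suc n} {suc k} pr _ k<p
  with euclidsLemma (suc k) (suc n C suc k) pr
         (ℕᵈ.divides (n C k) (trans (absorption n k) (ℕₚ.*-comm (suc n) (n C k))))
... | inj₁ p∣k = ⊥-elim (ℕₚ.<⇒≱ k<p (ℕᵈ.∣⇒≤ p∣k))
... | inj₂ p∣C = p∣C

prime⇒∤ : ∀ {p} d .{{_ : ℕ.NonTrivial d}} → Prime p → d < p → ¬ d ℕᵈ.∣ p
prime⇒∤ d pr d<p d∣p = Prime.notComposite pr (composite d<p d∣p)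

prime⇒positive : ∀ {p} → Prime p → 0 < p
prime⇒positive {p} pr = ℕ.>-nonZero⁻¹ p {{prime⇒nonZero pr}}

frobenius : ∀ {L p} → Multiplier L → Linear L → Prime p →
            ∀ i → + p ∣ power (id ⊞ L) p i - (one i + power L p i)
frobenius {L} {p} 𝓛 lin pr i =
  subst (+ p ∣_) outer-terms (∑-two-terms p G (prime⇒positive pr) ℕₚ.≤-refl inner-terms)
  where
  G : ℕ → ℤ
  G k = + (p C k) * power L k i
  inner-terms : ∀ k → k ≤ p → k ≢ 0 → k ≢ p → + p ∣ G k
  inner-terms k k≤p k≢0 k≢p =
    ∣m⇒∣m*n {m = + (p C k)} (power L k i) (∣ᵤ⇒∣ (prime∣binomial pr (ℕₚ.n≢0⇒n>0 k≢0) (ℕₚ.≤∧≢⇒< k≤p k≢p)))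
  top : G p ≡ power L p i
  top = trans (cong (λ c → + c * power L p i) (nCn≡1 p)) (ℤₚ.*-identityˡ _)
  outer-terms : ∑ p G - (G 0 + G p) ≡ power (id ⊞ L) p i - (one i + power L p i)
  outer-terms = sym (cong₂ _-_ (binomial 𝓛 lin p i)
                               (cong₂ _+_ (sym (ℤₚ.*-identityˡ (one i))) (sym top)))

times[x+x²] times[1+x+x²] times[1-x] times[1-x³] : Op
times[x+x²]   = shift ⊞ (shift ∘ shift)
times[1+x+x²] = id ⊞ times[x+x²]
times[1-x]    = id ⊟ shift
times[1-x³]   = id ⊟ (shift ∘ shift ∘ shift)

times[x+x²]-multiplier : Multiplier times[x+x²]
times[x+x²]-multiplier = ⊞-multiplier shift-multiplier (∘-multiplier shift-multiplier shift-multiplier)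

times[1+x+x²]-multiplier : Multiplier times[1+x+x²]
times[1+x+x²]-multiplier = ⊞-multiplier id-multiplier times[x+x²]-multiplier

times[1-x]-multiplier : Multiplier times[1-x]
times[1-x]-multiplier = ⊟-multiplier id-multiplier shift-multiplier

times[x+x²]-linear : Linear times[x+x²]
times[x+x²]-linear = ⊞-linear shift-linear (∘-linear shift-multiplier shift-linear shift-linear)

[1-x][1+x+x²]≗[1-x³] : ∀ f → times[1-x] (times[1+x+x²] f) ≗ times[1-x³] f
[1-x][1+x+x²]≗[1-x³] f i =
  trans (cong (λ z → times[1+x+x²] f i - z) (shift-comm i))
        (telescope (f i) (shift f i) (shift (shift f) i) (shift (shift (shift f)) i))
  where
  shift-comm : shift (times[1+x+x²] f) ≗ times[1+x+x²] (shift f)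
  shift-comm zero    = refl
  shift-comm (suc i) = refl
  telescope : ∀ a b c d → (a + (b + c)) - (b + (c + d)) ≡ a - d
  telescope = solve-∀

[x+x²]^_ [1+x+x²]^_ [1-x]^_ [1-x³]^_ : ℕ → Poly
[x+x²]^_   = power times[x+x²]
[1+x+x²]^_ = power times[1+x+x²]
[1-x]^_    = power times[1-x]
[1-x³]^_   = power times[1-x³]

-- (x+x²)ᵏ = xᵏ(1+x)ᵏ: no terms below xᵏ, and [x^(k+r)] = C(k,r).
[x+x²]^-low : ∀ k i → i < k → ([x+x²]^ k) i ≡ 0ℤ
[x+x²]^-low (suc k) zero    _         = refl
[x+x²]^-low (suc k) (suc i) (s≤s i<k) = cong₂ _+_ ([x+x²]^-low k i i<k) (shifted i i<k)
  where
  shifted : ∀ i → i < k → shift ([x+x²]^ k) i ≡ 0ℤ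
  shifted zero    _     = refl
  shifted (suc j) 1+j<k = [x+x²]^-low k j (ℕₚ.<⇒≤ 1+j<k)

[x+x²]^-high : ∀ k r → ([x+x²]^ k) (k ℕ.+ r) ≡ + (k C r)
[x+x²]^-high zero    zero    = refl
[x+x²]^-high zero    (suc r) = refl
[x+x²]^-high (suc k) zero    =
  cong₂ _+_ ([x+x²]^-high k 0) (trans (cong (shift E) (ℕₚ.+-identityʳ k)) (shift-top k))
  where
  E : Poly
  E = [x+x²]^ k
  shift-top : ∀ k → shift ([x+x²]^ k) k ≡ 0ℤ
  shift-top zero    = refl
  shift-top (suc k) = [x+x²]^-low (suc k) k ℕₚ.≤-refl
[x+x²]^-high (suc k) (suc r) = begin
    E (k ℕ.+ suc r) + shift E (k ℕ.+ suc r)  ≡⟨ cong (λ j → E (k ℕ.+ suc r) + shift E j) (ℕₚ.+-suc k r) ⟩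
    E (k ℕ.+ suc r) + E (k ℕ.+ r)            ≡⟨ cong₂ _+_ ([x+x²]^-high k (suc r)) ([x+x²]^-high k r) ⟩
    + (k C suc r) + + (k C r)                ≡⟨ ℤₚ.+-comm (+ (k C suc r)) (+ (k C r)) ⟩
    + (k C r) + + (k C suc r)                ≡⟨ ℤₚ.pos-+ (k C r) (k C suc r) ⟨
    + (k C r ℕ.+ k C suc r)                  ≡⟨ cong +_ (nCk+nC[k+1]≡[n+1]C[k+1] k r) ⟩
    + (suc k C suc r)                        ∎
  where
  E : Poly
  E = [x+x²]^ k

-- By the binomial theorem for 1 + (x+x²),
-- [x^(n+j)] = ∑ₖ C(n,k) C(k, n+j-k); reversing the sum gives Defs.T.
T-coefficient : ∀ n j → ([1+x+x²]^ n) (n ℕ.+ j) ≡ + T n j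
T-coefficient n j = begin
    ([1+x+x²]^ n) (n ℕ.+ j)
  ≡⟨ binomial times[x+x²]-multiplier times[x+x²]-linear n (n ℕ.+ j) ⟩
    ∑ n (λ k → + (n C k) * ([x+x²]^ k) (n ℕ.+ j))
  ≡⟨ ∑-reverse n _ ⟩
    ∑ n (λ k → + (n C (n ∸ k)) * ([x+x²]^ (n ∸ k)) (n ℕ.+ j))
  ≡⟨ ∑-cong n term ⟩
    ∑ n (λ k → + ((n C k) ℕ.* ((n ∸ k) C (k ℕ.+ j))))
  ≡⟨ ∑-sumTo n _ ⟨
    + T n j ∎
  where
  index : ∀ k → k ≤ n → n ℕ.+ j ≡ (n ∸ k) ℕ.+ (k ℕ.+ j)
  index k k≤n = trans (cong (ℕ._+ j) (sym (ℕₚ.m∸n+n≡m k≤n))) (ℕₚ.+-assoc (n ∸ k) k j)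
  term : ∀ k → k ≤ n → + (n C (n ∸ k)) * ([x+x²]^ (n ∸ k)) (n ℕ.+ j) ≡ + ((n C k) ℕ.* ((n ∸ k) C (k ℕ.+ j)))
  term k k≤n = begin
      + (n C (n ∸ k)) * ([x+x²]^ (n ∸ k)) (n ℕ.+ j)
    ≡⟨ cong₂ (λ a b → + a * b) (sym (nCk≡nC[n∸k] k≤n))
                               (trans (cong ([x+x²]^ (n ∸ k)) (index k k≤n)) ([x+x²]^-high (n ∸ k) (k ℕ.+ j))) ⟩
      + (n C k) * + ((n ∸ k) C (k ℕ.+ j))
    ≡⟨ ℤₚ.pos-* (n C k) _ ⟨
      + ((n C k) ℕ.* ((n ∸ k) C (k ℕ.+ j))) ∎

sign : ℕ → ℤ
sign zero    = 1ℤ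
sign (suc i) = - sign i

sign-odd : ∀ n → ¬ 2 ℕᵈ.∣ n → sign n ≡ -1ℤ
sign-odd zero          2∤0 = ⊥-elim (2∤0 (2 ℕᵈ.∣0))
sign-odd (suc zero)    _   = refl
sign-odd (suc (suc n)) 2∤n = trans (ℤₚ.neg-involutive (sign n))
                                   (sign-odd n (λ 2∣n → 2∤n (ℕᵈ.∣m∣n⇒∣m+n ℕᵈ.∣-refl 2∣n)))

[1-x]^-coefficient : ∀ n i → ([1-x]^ n) i ≡ sign i * + (n C i)
[1-x]^-coefficient zero    zero    = refl
[1-x]^-coefficient zero    (suc i) = sym (ℤₚ.*-zeroʳ (sign (suc i)))
[1-x]^-coefficient (suc n) zero    = cong (_- 0ℤ) ([1-x]^-coefficient n 0)
[1-x]^-coefficient (suc n) (suc i) = begin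
    ([1-x]^ n) (suc i) - ([1-x]^ n) i
  ≡⟨ cong₂ _-_ ([1-x]^-coefficient n (suc i)) ([1-x]^-coefficient n i) ⟩
    - sign i * + (n C suc i) - sign i * + (n C i)
  ≡⟨ collect (sign i) (+ (n C suc i)) (+ (n C i)) ⟩
    - sign i * (+ (n C i) + + (n C suc i))
  ≡⟨ cong (λ c → - sign i * c) (trans (sym (ℤₚ.pos-+ (n C i) (n C suc i))) (cong +_ (nCk+nC[k+1]≡[n+1]C[k+1] n i))) ⟩
    - sign i * + (suc n C suc i) ∎
  where
  collect : ∀ s a b → - s * a - s * b ≡ - s * (b + a)
  collect = solve-∀

[1-x³]^-sparse : ∀ n i → ¬ 3 ℕᵈ.∣ i → ([1-x³]^ n) i ≡ 0ℤ
[1-x³]^-sparse n       zero                3∤0 = ⊥-elim (3∤0 (3 ℕᵈ.∣0))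
[1-x³]^-sparse zero    (suc i)             _   = refl
[1-x³]^-sparse (suc n) (suc zero)          3∤i = cong (_- 0ℤ) ([1-x³]^-sparse n 1 3∤i)
[1-x³]^-sparse (suc n) (suc (suc zero))    3∤i = cong (_- 0ℤ) ([1-x³]^-sparse n 2 3∤i)
[1-x³]^-sparse (suc n) (suc (suc (suc i))) 3∤i =
  cong₂ _-_ ([1-x³]^-sparse n (3 ℕ.+ i) 3∤i)
            ([1-x³]^-sparse n i (λ 3∣i → 3∤i (ℕᵈ.∣m∣n⇒∣m+n ℕᵈ.∣-refl 3∣i)))

[1+x+x²]^-constant : ∀ n → ([1+x+x²]^ n) 0 ≡ 1ℤ
[1+x+x²]^-constant zero    = refl
[1+x+x²]^-constant (suc n) = cong (_+ 0ℤ) ([1+x+x²]^-constant n)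

[1+x+x²]^-vanishing : ∀ n i → n ℕ.+ n < i → ([1+x+x²]^ n) i ≡ 0ℤ
[1+x+x²]^-vanishing zero    (suc i)       _                 = refl
[1+x+x²]^-vanishing (suc n) (suc (suc i)) (s≤s (s≤s 2n+1<i)) =
  cong₂ _+_ (vanishing (suc (suc i)) (ℕₚ.m<n⇒m<1+n (ℕₚ.m<n⇒m<1+n 2n<i)))
            (cong₂ _+_ (vanishing (suc i) (ℕₚ.m<n⇒m<1+n 2n<i)) (vanishing i 2n<i))
  where
  vanishing : ∀ i → n ℕ.+ n < i → ([1+x+x²]^ n) i ≡ 0ℤ
  vanishing = [1+x+x²]^-vanishing n
  2n<i : n ℕ.+ n < i
  2n<i = subst (_≤ i) (ℕₚ.+-suc n n) 2n+1<i

[1+x+x²]^-leading : ∀ n → ([1+x+x²]^ n) (n ℕ.+ n) ≡ 1ℤ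
[1+x+x²]^-leading zero    = refl
[1+x+x²]^-leading (suc n) = begin
    ([1+x+x²]^ suc n) (suc (n ℕ.+ suc n))
  ≡⟨ cong (λ j → ([1+x+x²]^ suc n) (suc j)) (ℕₚ.+-suc n n) ⟩
    P (2 ℕ.+ (n ℕ.+ n)) + (P (1 ℕ.+ (n ℕ.+ n)) + P (n ℕ.+ n))
  ≡⟨ cong₂ _+_ (vanishing _ (ℕₚ.m<n⇒m<1+n ℕₚ.≤-refl))
               (cong₂ _+_ (vanishing _ ℕₚ.≤-refl) ([1+x+x²]^-leading n)) ⟩
    1ℤ ∎
  where
  P : Poly
  P = [1+x+x²]^ n
  vanishing : ∀ i → n ℕ.+ n < i → P i ≡ 0ℤ
  vanishing = [1+x+x²]^-vanishing n

-- (x+x²)ᵖ = xᵖ(1+x)ᵖ: below x²ᵖ, its coefficients other than [xᵖ] are 0 or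
-- C(p,r) with 0 < r < p, hence divisible by p.
[x+x²]^p-divisible : ∀ {p i} → Prime p → i < p ℕ.+ p → i ≢ p → + p ∣ ([x+x²]^ p) i
[x+x²]^p-divisible {p} {i} pr i<2p i≢p with ℕₚ.<-cmp i p
... | tri< i<p _ _ = subst (+ p ∣_) (sym ([x+x²]^-low p i i<p)) ((+ p) ∣0)
... | tri≈ _ i≡p _ = ⊥-elim (i≢p i≡p)
... | tri> _ _ p<i =
  subst (+ p ∣_) (sym coefficient)
        (∣ᵤ⇒∣ (prime∣binomial pr (ℕₚ.m<n⇒0<n∸m p<i)
                                (ℕₚ.m<n+o⇒m∸n<o i p {{prime⇒nonZero pr}} i<2p)))
  where
  coefficient : ([x+x²]^ p) i ≡ + (p C (i ∸ p))
  coefficient = trans (cong ([x+x²]^ p) (sym (ℕₚ.m+[n∸m]≡n (ℕₚ.<⇒≤ p<i)))) ([x+x²]^-high p (i ∸ p))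

-- By Frobenius, p divides [xⁱ] (1+x+x²)ᵖ for 0 < i < 2p, i ≠ p.
[1+x+x²]^p-divisible : ∀ {p i} → Prime p → 0 < i → i < p ℕ.+ p → i ≢ p → + p ∣ ([1+x+x²]^ p) i
[1+x+x²]^p-divisible {p} {suc i} pr _ i<2p i≢p =
  subst (+ p ∣_) (cancel _ _)
        (∣m∣n⇒∣m+n (frobenius times[x+x²]-multiplier times[x+x²]-linear pr (suc i))
                   ([x+x²]^p-divisible pr i<2p i≢p))
  where
  cancel : ∀ a b → (a - (0ℤ + b)) + b ≡ a
  cancel = solve-∀

-- [xᵖ] (1+x+x²)ᵖ ≡ 1 (mod p²) for primes p with 2 ∤ p and 3 ∤ p: the
-- coefficient [xᵖ] of (1-x)ᵖ(1+x+x²)ᵖ = (1-x³)ᵖ vanishes, and in its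
-- convolution sum only the terms i = 0 and i = p survive modulo p².
central-coefficient : ∀ {p} → Prime p → ¬ 2 ℕᵈ.∣ p → ¬ 3 ℕᵈ.∣ p →
                      + p * + p ∣ ([1+x+x²]^ p) p - 1ℤ
central-coefficient {p} pr 2∤p 3∤p =
  subst (+ p * + p ∣_) outer-terms
        (∣m⇒∣-m (∑-two-terms p f (prime⇒positive pr) ℕₚ.≤-refl inner-terms))
  where
  P : Poly
  P = [1+x+x²]^ p
  f : ℕ → ℤ
  f i = ([1-x]^ p) i * P (p ∸ i)
  inner-terms : ∀ i → i ≤ p → i ≢ 0 → i ≢ p → + p * + p ∣ f i
  inner-terms i i≤p i≢0 i≢p =
    ∣-* (subst (+ p ∣_) (sym ([1-x]^-coefficient p i))
               (∣n⇒∣m*n (sign i) (∣ᵤ⇒∣ (prime∣binomial pr 0<i i<p))))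
        ([1+x+x²]^p-divisible pr (ℕₚ.m<n⇒0<n∸m i<p) (ℕₚ.<-≤-trans p∸i<p (ℕₚ.m≤m+n p p))
                                 (λ e → ℕₚ.<-irrefl e p∸i<p))
    where
    0<i : 0 < i
    0<i = ℕₚ.n≢0⇒n>0 i≢0
    i<p : i < p
    i<p = ℕₚ.≤∧≢⇒< i≤p i≢p
    p∸i<p : p ∸ i < p
    p∸i<p = ℕₚ.∸-monoʳ-< 0<i i≤p
  sum-vanishes : ∑ p f ≡ 0ℤ
  sum-vanishes =
    trans (power-⊛ times[1-x]-multiplier times[1+x+x²]-multiplier [1-x][1+x+x²]≗[1-x³] p p)
          ([1-x³]^-sparse p p 3∤p)
  first : f 0 ≡ P p
  first = trans (cong (_* P p) ([1-x]^-coefficient p 0)) (ℤₚ.*-identityˡ (P p))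
  last : f p ≡ -1ℤ
  last = cong₂ _*_ (trans ([1-x]^-coefficient p p) (cong₂ _*_ (sign-odd p 2∤p) (cong +_ (nCn≡1 p))))
                   (trans (cong P (ℕₚ.n∸n≡0 p)) ([1+x+x²]^-constant p))
  simplify : ∀ c → - (0ℤ - (c + -1ℤ)) ≡ c - 1ℤ
  simplify = solve-∀
  outer-terms : - (∑ p f - (f 0 + f p)) ≡ P p - 1ℤ
  outer-terms = trans (cong₂ (λ s t → - (s - t)) sum-vanishes (cong₂ _+_ first last)) (simplify (P p))

-- [x³ᵖ] (1+x+x²)²ᵖ ≡ 2·[xᵖ] (1+x+x²)ᵖ (mod p²): in the convolution sum for
-- (1+x+x²)ᵖ·(1+x+x²)ᵖ only the terms i = p and i = 2p survive modulo p².
double-coefficient : ∀ {p} → Prime p →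
  + p * + p ∣ ([1+x+x²]^ (p ℕ.+ p)) (p ℕ.+ p ℕ.+ p) - (([1+x+x²]^ p) p + ([1+x+x²]^ p) p)
double-coefficient {p} pr =
  subst (+ p * + p ∣_) outer-terms
        (∑-two-terms N f (ℕₚ.m<m+n p 0<p) (ℕₚ.m≤m+n (p ℕ.+ p) p) inner-terms)
  where
  P : Poly
  P = [1+x+x²]^ p
  N : ℕ
  N = p ℕ.+ p ℕ.+ p
  f : ℕ → ℤ
  f i = P i * P (N ∸ i)
  0<p : 0 < p
  0<p = prime⇒positive pr
  N∸p≡2p : N ∸ p ≡ p ℕ.+ p
  N∸p≡2p = ℕₚ.m+n∸n≡m (p ℕ.+ p) p
  N∸2p≡p : N ∸ (p ℕ.+ p) ≡ p
  N∸2p≡p = ℕₚ.m+n∸m≡n (p ℕ.+ p) p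
  middle : ∀ j → p < j → j < p ℕ.+ p → + p ∣ P j
  middle j p<j j<2p =
    [1+x+x²]^p-divisible pr (ℕₚ.<-trans 0<p p<j) j<2p (λ e → ℕₚ.<-irrefl (sym e) p<j)
  inner-terms : ∀ i → i ≤ N → i ≢ p → i ≢ p ℕ.+ p → + p * + p ∣ f i
  inner-terms i i≤N i≢p i≢2p with ℕₚ.<-cmp i p
  ... | tri< i<p _ _ =
    subst (_ ∣_) (sym (trans (cong (P i *_) ([1+x+x²]^-vanishing p (N ∸ i) 2p<N∸i)) (ℤₚ.*-zeroʳ (P i))))
          (_ ∣0)
    where
    2p<N∸i : p ℕ.+ p < N ∸ i
    2p<N∸i = subst (_< N ∸ i) N∸p≡2p (ℕₚ.∸-monoʳ-< i<p (ℕₚ.m≤n⇒m≤o+n (p ℕ.+ p) ℕₚ.≤-refl))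
  ... | tri≈ _ i≡p _ = ⊥-elim (i≢p i≡p)
  ... | tri> _ _ p<i with ℕₚ.<-cmp i (p ℕ.+ p)
  ...   | tri< i<2p _ _ =
    ∣-* (middle i p<i i<2p)
        (middle (N ∸ i) (subst (_< N ∸ i) N∸2p≡p (ℕₚ.∸-monoʳ-< i<2p (ℕₚ.m≤m+n (p ℕ.+ p) p)))
                        (subst (N ∸ i <_) N∸p≡2p (ℕₚ.∸-monoʳ-< p<i i≤N)))
  ...   | tri≈ _ i≡2p _ = ⊥-elim (i≢2p i≡2p)
  ...   | tri> _ _ 2p<i =
    subst (_ ∣_) (sym (trans (cong (_* P (N ∸ i)) ([1+x+x²]^-vanishing p i 2p<i)) (ℤₚ.*-zeroˡ (P (N ∸ i)))))
          (_ ∣0)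
  first : f p ≡ P p
  first = begin
    P p * P (N ∸ p)       ≡⟨ cong (λ j → P p * P j) N∸p≡2p ⟩
    P p * P (p ℕ.+ p)     ≡⟨ cong (λ c → P p * c) ([1+x+x²]^-leading p) ⟩
    P p * 1ℤ              ≡⟨ ℤₚ.*-identityʳ (P p) ⟩
    P p                   ∎
  last : f (p ℕ.+ p) ≡ P p
  last = trans (cong₂ _*_ ([1+x+x²]^-leading p) (cong P N∸2p≡p)) (ℤₚ.*-identityˡ (P p))
  outer-terms : ∑ N f - (f p + f (p ℕ.+ p)) ≡ ([1+x+x²]^ (p ℕ.+ p)) N - (P p + P p)
  outer-terms = cong₂ _-_ (power-+ times[1+x+x²]-multiplier p p N) (cong₂ _+_ first last)

theorem1 : (p : ℕ) → Prime p → 5 ≤ p →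
    (+ (p ℕ.* p)) Unsigned.∣ ((+ T (2 ℕ.* p) p) - (+ 2))
theorem1 p pr 5≤p =
  ∣⇒∣ᵤ (subst₂ _∣_ (sym (ℤₚ.pos-* p p)) combine
               (∣m∣n⇒∣m+n (double-coefficient pr) (∣m∣n⇒∣m+n central central)))
  where
  c : ℤ
  c = ([1+x+x²]^ p) p
  central : + p * + p ∣ c - 1ℤ
  central = central-coefficient pr (prime⇒∤ 2 pr (ℕₚ.≤-trans (ℕₚ.m≤m+n 3 2) 5≤p))
                                   (prime⇒∤ 3 pr (ℕₚ.≤-trans (ℕₚ.m≤m+n 4 1) 5≤p))
  t : ℤ
  t = ([1+x+x²]^ (p ℕ.+ p)) (p ℕ.+ p ℕ.+ p)
  T≡ : t ≡ + T (2 ℕ.* p) p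
  T≡ = trans (cong (λ n → ([1+x+x²]^ n) (n ℕ.+ p)) (sym (cong (p ℕ.+_) (ℕₚ.+-identityʳ p))))
             (T-coefficient (2 ℕ.* p) p)
  rearrange : ∀ t c → (t - (c + c)) + ((c - 1ℤ) + (c - 1ℤ)) ≡ t - + 2
  rearrange = solve-∀
  combine : (t - (c + c)) + ((c - 1ℤ) + (c - 1ℤ)) ≡ + T (2 ℕ.* p) p - + 2
  combine = trans (rearrange t c) (cong (_- + 2) T≡)
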